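{- Let $\Psi\in\{\mathfrak F,\mathfrak B\}$, let $\alpha,\beta$ satisfy $2<\alpha\le 3$ and $4\alpha-\beta=6$, and let $G\in\mathcal G(\Psi,\alpha,\beta)$. Then for no vertex $v$ of $G$ is the subgraph induced on its neighborhood $N(v)$ a complete graph.
   Context: All graphs are finite and simple. $|G|$ is the number of vertices, $e(G)$ the number of edges, $G|_X$ the subgraph induced on $X$. $q_{\alpha,\beta}(G)=\alpha|G|-e(G)-\beta$. $\mathfrak F$ is the class of forests and $\mathfrak B$ the class of bipartite graphs. A vertex cut is a vertex set whose removal disconnects the graph; a $\Psi$-cut of $G$ is a vertex cut $M$ with $G|_M\in\Psi$. $\mathcal G(\Psi,\alpha,\beta)$ is the set of graphs $G$ such that $|G|\ge4$, $q_{\alpha,\beta}(G)>0$, $G$ has no $\Psi$-cut, and $G$ has the smallest number of vertices among all graphs with these three properties.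
   Formalization: The parameters α and β are rational rather than real. -}

module Defs where

open import Data.Nat as ℕ using (ℕ; zero; suc; _<ᵇ_)
open import Data.Bool using (Bool; true; false; _∧_; if_then_else_)
open import Data.Fin using (Fin; toℕ)
open import Data.Fin.Subset using (Subset; _∈_; _∉_)
open import Data.List using (List; []; _∷_; _++_; [_]; map; allFin)
open import Data.Nat.ListAction using (sum)
open import Data.List.Relation.Unary.All using (All)
open import Data.List.Relation.Unary.Unique.Propositional using (Unique)
open import Data.Integer using (+_)
open import Data.Rational using (ℚ; _/_; _-_; _*_; _<_; 0ℚ)
open import Data.Product using (Σ; ∃; ∃-syntax; _×_)
open import Data.Unit using (⊤)
open import Relation.Binary.PropositionalEquality using (_≡_; _≢_)
open import Relation.Nullary using (¬_)

record Graph : Set where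
  field
    n      : ℕ
    adj    : Fin n → Fin n → Bool
    sym    : ∀ u v → adj u v ≡ adj v u
    irrefl : ∀ v → adj v v ≡ false
open Graph public

∣_∣ᵥ : Graph → ℕ
∣ G ∣ᵥ = n G

e : Graph → ℕ
e G = sum (map (λ u → sum (map (λ v → if (toℕ u <ᵇ toℕ v) ∧ adj G u v then 1 else 0)
                              (allFin (n G))))
               (allFin (n G)))

ℕ→ℚ : ℕ → ℚ
ℕ→ℚ k = (+ k) / 1

q : ℚ → ℚ → Graph → ℚ
q α β G = α * ℕ→ℚ ∣ G ∣ᵥ - ℕ→ℚ (e G) - β

AdjChain : (G : Graph) → List (Fin (n G)) → Set
AdjChain G []            = ⊤
AdjChain G (x ∷ [])      = ⊤
AdjChain G (x ∷ y ∷ r)   = (adj G x y ≡ true) × AdjChain G (y ∷ r)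

HasCycleIn : (G : Graph) → Subset (n G) → Set
HasCycleIn G M =
  Σ (List (Fin (n G))) λ vs →
    Σ (Fin (n G)) λ x → Σ (Fin (n G)) λ y → Σ (Fin (n G)) λ z →
    Σ (List (Fin (n G))) λ rest →
      (vs ≡ x ∷ y ∷ z ∷ rest) × Unique vs × All (_∈ M) vs × AdjChain G (vs ++ [ x ])

ForestOn : (G : Graph) → Subset (n G) → Set
ForestOn G M = ¬ HasCycleIn G M

BipartiteOn : (G : Graph) → Subset (n G) → Set
BipartiteOn G M = Σ (Fin (n G) → Bool) λ c →
  ∀ u v → u ∈ M → v ∈ M → adj G u v ≡ true → c u ≢ c v

data Ψ-Class : Set where
  𝔉 𝔅 : Ψ-Class

InClass : Ψ-Class → (G : Graph) → Subset (n G) → Set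
InClass 𝔉 G M = ForestOn G M
InClass 𝔅 G M = BipartiteOn G M

-- reachability in G − M (all vertices after the start lie outside M)
data ReachAvoid (G : Graph) (M : Subset (n G)) : Fin (n G) → Fin (n G) → Set where
  here : ∀ {u} → ReachAvoid G M u u
  step : ∀ {u v w} → adj G u v ≡ true → v ∉ M → ReachAvoid G M v w → ReachAvoid G M u w

VertexCut : (G : Graph) → Subset (n G) → Set
VertexCut G M = ∃[ u ] ∃[ w ] (u ∉ M × w ∉ M × ¬ ReachAvoid G M u w)

ΨCut : Ψ-Class → (G : Graph) → Subset (n G) → Set
ΨCut Ψ G M = VertexCut G M × InClass Ψ G M

Admissible : Ψ-Class → ℚ → ℚ → Graph → Set
Admissible Ψ α β G = (4 ℕ.≤ ∣ G ∣ᵥ) × (0ℚ < q α β G) × (∀ M → ¬ ΨCut Ψ G M)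

In𝒢 : Ψ-Class → ℚ → ℚ → Graph → Set
In𝒢 Ψ α β G = Admissible Ψ α β G × (∀ H → Admissible Ψ α β H → ∣ G ∣ᵥ ℕ.≤ ∣ H ∣ᵥ)

NeighbourhoodComplete : (G : Graph) → Fin (n G) → Set
NeighbourhoodComplete G v =
  ∀ x y → adj G v x ≡ true → adj G v y ≡ true → x ≢ y → adj G x y ≡ true

-- If v has at most two neighbours, N(v) is a set of at most two vertices, hence a forest
-- and bipartite, and it separates v from a non-neighbour: a Ψ-cut.  Otherwise deg v ≥ 3.
-- If |G| = 4 this makes G = K₄, and q(K₄) = 4α − 6 − β = 0.  If |G| ≥ 5 then
-- q(G − v) = q(G) + deg v − α > 0 because α ≤ 3, and every Ψ-cut M of G − v is a Ψ-cut of G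
-- (with v outside M), since a path through v can jump directly between the two neighbours
-- of v it uses.  So G − v is a smaller admissible graph, contradicting minimality.
module Submission where

open import Defs
open import Data.Rational using (ℚ; _<_; _≤_; _*_; _-_)
open import Data.Fin using (Fin)
open import Relation.Binary.PropositionalEquality using (_≡_)
open import Relation.Nullary using (¬_)

open import Function using (_∘_)
open import Data.Nat as ℕ using (ℕ; zero; suc; pred; _<ᵇ_; s≤s; z≤n)
import Data.Nat.Properties as ℕP
open import Algebra.Properties.CommutativeSemigroup ℕP.+-commutativeSemigroup
  using (interchange; x∙yz≈y∙xz)
open import Data.Fin as F using (zero; suc; toℕ; punchIn; punchOut)
import Data.Fin.Properties as FP
open import Data.Fin.Subset as S using (Subset; outside)
import Data.Fin.Subset.Properties as SP
open import Data.Bool using (Bool; true; false; _∧_; if_then_else_)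
open import Data.List as L using ([]; _∷_)
import Data.List.Properties as LP
open import Data.List.Relation.Unary.All as All using (All; []; _∷_)
import Data.List.Relation.Unary.All.Properties as AllP
open import Data.List.Relation.Unary.AllPairs using ([]; _∷_)
open import Data.List.Relation.Unary.Unique.Propositional using (Unique)
open import Data.Nat.ListAction using (sum)
import Data.Vec as V
import Data.Vec.Properties as VP
open import Data.Product using (Σ; ∃; _×_; _,_)
open import Data.Sum using (_⊎_; inj₁; inj₂)
open import Data.Unit using (tt)
open import Data.Empty using (⊥; ⊥-elim)
open import Relation.Binary.Definitions using (tri<; tri≈; tri>)
import Relation.Binary.PropositionalEquality as Eq
open Eq using (_≢_; refl; cong; cong₂; trans; subst; subst₂)
open import Relation.Nullary using (yes; no; does; Dec)
open import Relation.Nullary.Decidable using (¬?; _×-dec_; _→-dec_; _⊎-dec_; from-yes; dec-true; dec-false)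
import Data.Rational as Q
import Data.Rational.Properties as QP
open import Data.Rational.Solver using () renaming (module +-*-Solver to ℚ-Solver)
import Data.Integer as ℤ
import Data.Integer.Properties as ℤP
import Data.Nat.Coprimality as Cop

adj⇒≢ : ∀ G {u w} → adj G u w ≡ true → u ≢ w
adj⇒≢ G {u} u~u refl with trans (Eq.sym u~u) (irrefl G u)
... | ()

𝟙 : Bool → ℕ
𝟙 b = if b then 1 else 0

∑ : ∀ {k} → (Fin k → ℕ) → ℕ
∑ f = sum (L.tabulate f)

∑-cong : ∀ {k} {f g : Fin k → ℕ} → (∀ i → f i ≡ g i) → ∑ f ≡ ∑ g
∑-cong {zero}  f≗g = refl
∑-cong {suc k} f≗g = cong₂ ℕ._+_ (f≗g zero) (∑-cong (f≗g ∘ suc))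

∑-mono-≤ : ∀ {k} {f g : Fin k → ℕ} → (∀ i → f i ℕ.≤ g i) → ∑ f ℕ.≤ ∑ g
∑-mono-≤ {zero}  f≤g = z≤n
∑-mono-≤ {suc k} f≤g = ℕP.+-mono-≤ (f≤g zero) (∑-mono-≤ (f≤g ∘ suc))

∑-distrib-+ : ∀ {k} (f g : Fin k → ℕ) → ∑ (λ i → f i ℕ.+ g i) ≡ ∑ f ℕ.+ ∑ g
∑-distrib-+ {zero}  f g = refl
∑-distrib-+ {suc k} f g = trans (cong (f zero ℕ.+ g zero ℕ.+_) (∑-distrib-+ (f ∘ suc) (g ∘ suc)))
                                (interchange (f zero) (g zero) _ _)

∑-zero : ∀ {k} (f : Fin k → ℕ) → (∀ i → f i ≡ 0) → ∑ f ≡ 0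
∑-zero {zero}  f f≗0 = refl
∑-zero {suc k} f f≗0 rewrite f≗0 zero = ∑-zero (f ∘ suc) (f≗0 ∘ suc)

skip : ∀ {k} → Fin k → Fin (pred k) → Fin k
skip {suc _} = punchIn

-- a left inverse of skip v; d is a junk value returned at v itself
unskip : ∀ {k} → Fin k → Fin (pred k) → Fin k → Fin (pred k)
unskip {suc _} v d w with v F.≟ w
... | yes _   = d
... | no v≢w = punchOut v≢w

suc-pred : ∀ {k} → Fin k → suc (pred k) ≡ k
suc-pred {suc _} _ = refl

skip-≢ : ∀ {k} (v : Fin k) i → skip v i ≢ v
skip-≢ {suc _} = FP.punchInᵢ≢i

skip-injective : ∀ {k} (v : Fin k) {i j} → skip v i ≡ skip v j → i ≡ j
skip-injective {suc _} v = FP.punchIn-injective v _ _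

unskip-skip : ∀ {k} (v : Fin k) d i → unskip v d (skip v i) ≡ i
unskip-skip {suc _} v d i with v F.≟ punchIn v i
... | yes v≡ = ⊥-elim (skip-≢ v i (Eq.sym v≡))
... | no _   = trans (FP.punchOut-cong v refl) (FP.punchOut-punchIn v)

skip-unskip : ∀ {k} (v : Fin k) d {w} → w ≢ v → skip v (unskip v d w) ≡ w
skip-unskip {suc _} v d {w} w≢v with v F.≟ w
... | yes v≡w = ⊥-elim (w≢v (Eq.sym v≡w))
... | no v≢w  = FP.punchIn-punchOut v≢w

∑-split : ∀ {k} (v : Fin k) (f : Fin k → ℕ) → ∑ f ≡ f v ℕ.+ ∑ (f ∘ skip v)
∑-split {suc k}       zero    f = refl
∑-split {suc (suc k)} (suc v) f =
  trans (cong (f zero ℕ.+_) (∑-split v (f ∘ suc))) (x∙yz≈y∙xz (f zero) (f (suc v)) _)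

δ : ∀ {k} → Fin k → Fin k → ℕ
δ x w = 𝟙 (does (w F.≟ x))

∑-δ : ∀ {k} (x : Fin k) → ∑ (δ x) ≡ 1
∑-δ x rewrite ∑-split x (δ x) | dec-true (x F.≟ x) refl =
  cong suc (∑-zero _ λ i → cong 𝟙 (dec-false (skip x i F.≟ x) (skip-≢ x i)))

_─_ : (G : Graph) → Fin (n G) → Graph
G ─ v = record
  { n      = pred (n G)
  ; adj    = λ i j → adj G (skip v i) (skip v j)
  ; sym    = λ i j → sym G (skip v i) (skip v j)
  ; irrefl = λ i → irrefl G (skip v i)
  }

ThreeMembers : ∀ {k} → Subset k → Set
ThreeMembers {k} M = Σ (Fin k) λ x → Σ (Fin k) λ y → Σ (Fin k) λ z →
  (x ≢ y × x ≢ z × y ≢ z) × (x S.∈ M × y S.∈ M × z S.∈ M)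

threeMembers? : ∀ {k} (M : Subset k) → Dec (ThreeMembers M)
threeMembers? M = FP.any? λ x → FP.any? λ y → FP.any? λ z →
  (¬? (x F.≟ y) ×-dec ¬? (x F.≟ z) ×-dec ¬? (y F.≟ z)) ×-dec (x SP.∈? M ×-dec y SP.∈? M ×-dec z SP.∈? M)

ThreeMembers-⊤ : ∀ {m} → 3 ℕ.≤ m → ThreeMembers (S.⊤ {m})
ThreeMembers-⊤ (s≤s (s≤s (s≤s _))) =
  zero , suc zero , suc (suc zero) , ((λ ()) , (λ ()) , (λ ())) , (SP.∈⊤ , SP.∈⊤ , SP.∈⊤)

3≤∑ : ∀ {k} {M : Subset k} (f : Fin k → ℕ) → (∀ {w} → w S.∈ M → 1 ℕ.≤ f w) → ThreeMembers M → 3 ℕ.≤ ∑ f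
3≤∑ f pos (x , y , z , (x≢y , x≢z , y≢z) , (x∈ , y∈ , z∈)) = begin
  3
    ≡⟨ cong₂ ℕ._+_ (∑-δ x) (cong₂ ℕ._+_ (∑-δ y) (∑-δ z)) ⟨
  ∑ (δ x) ℕ.+ (∑ (δ y) ℕ.+ ∑ (δ z))
    ≡⟨ trans (∑-distrib-+ (δ x) _) (cong (∑ (δ x) ℕ.+_) (∑-distrib-+ (δ y) (δ z))) ⟨
  ∑ (λ w → δ x w ℕ.+ (δ y w ℕ.+ δ z w))
    ≤⟨ ∑-mono-≤ bound ⟩
  ∑ f ∎
  where
  open ℕP.≤-Reasoning
  bound : ∀ w → δ x w ℕ.+ (δ y w ℕ.+ δ z w) ℕ.≤ f w
  bound w with w F.≟ x | w F.≟ y | w F.≟ z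
  ... | yes refl | yes refl | _        = ⊥-elim (x≢y refl)
  ... | yes refl | _        | yes refl = ⊥-elim (x≢z refl)
  ... | _        | yes refl | yes refl = ⊥-elim (y≢z refl)
  ... | yes refl | no _     | no _     = pos x∈
  ... | no _     | yes refl | no _     = pos y∈
  ... | no _     | no _     | yes refl = pos z∈
  ... | no _     | no _     | no _     = z≤n

sparse⇒forest : ∀ G {M} → ¬ ThreeMembers M → ForestOn G M
sparse⇒forest G few (_ , x , y , z , _ , refl , (x≢y ∷ x≢z ∷ _) ∷ (y≢z ∷ _) ∷ _ , x∈ ∷ y∈ ∷ z∈ ∷ _ , _) =
  few (x , y , z , (x≢y , x≢z , y≢z) , (x∈ , y∈ , z∈))

-- A member is coloured by whether some member precedes it.
sparse⇒bipartite : ∀ G {M} → ¬ ThreeMembers M → BipartiteOn G M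
sparse⇒bipartite G {M} few = colour , proper
  where
  preceded? : ∀ u → Dec (∃ λ t → t S.∈ M × t F.< u)
  preceded? u = FP.any? λ t → (t SP.∈? M) ×-dec (t F.<? u)

  colour : Fin (n G) → Bool
  colour u = does (preceded? u)

  ordered : ∀ {u w} → u S.∈ M → w S.∈ M → u F.< w → colour u ≢ colour w
  ordered {u} {w} u∈ w∈ u<w same with preceded? u | dec-true (preceded? w) (u , u∈ , u<w)
  ... | yes (t , t∈ , t<u) | _ =
    few (t , u , w , (FP.<⇒≢ t<u , FP.<⇒≢ (FP.<-trans t<u u<w) , FP.<⇒≢ u<w) , (t∈ , u∈ , w∈))
  ... | no _ | w-preceded with trans same w-preceded
  ...   | ()

  proper : ∀ u w → u S.∈ M → w S.∈ M → adj G u w ≡ true → colour u ≢ colour w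
  proper u w u∈ w∈ u~w with FP.<-cmp u w
  ... | tri< u<w _ _ = ordered u∈ w∈ u<w
  ... | tri≈ _ u≡w _ = ⊥-elim (adj⇒≢ G u~w u≡w)
  ... | tri> _ _ w<u = ordered w∈ u∈ w<u ∘ Eq.sym

sparse⇒InClass : ∀ Ψ G {M} → ¬ ThreeMembers M → InClass Ψ G M
sparse⇒InClass 𝔉 = sparse⇒forest
sparse⇒InClass 𝔅 = sparse⇒bipartite

<ᵇ-true : ∀ {a b} → a ℕ.< b → (a <ᵇ b) ≡ true
<ᵇ-true {zero}  {suc b} _         = refl
<ᵇ-true {suc a} {suc b} (s≤s a<b) = <ᵇ-true a<b

<ᵇ-false : ∀ {a b} → b ℕ.≤ a → (a <ᵇ b) ≡ false
<ᵇ-false {a}     {zero}  _         = refl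
<ᵇ-false {suc a} {suc b} (s≤s b≤a) = <ᵇ-false b≤a

<ᵇ-punchIn : ∀ {k} (v : Fin (suc k)) i j → (toℕ (punchIn v i) <ᵇ toℕ (punchIn v j)) ≡ (toℕ i <ᵇ toℕ j)
<ᵇ-punchIn zero    i       j       = refl
<ᵇ-punchIn (suc v) zero    zero    = refl
<ᵇ-punchIn (suc v) zero    (suc j) = refl
<ᵇ-punchIn (suc v) (suc i) zero    = refl
<ᵇ-punchIn (suc v) (suc i) (suc j) = <ᵇ-punchIn v i j

forwardEdge : (G : Graph) → Fin (n G) → Fin (n G) → ℕ
forwardEdge G u w = 𝟙 ((toℕ u <ᵇ toℕ w) ∧ adj G u w)

degree : (G : Graph) → Fin (n G) → ℕ
degree G v = ∑ (𝟙 ∘ adj G v)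

e≡∑∑forwardEdge : ∀ G → e G ≡ ∑ (λ u → ∑ (forwardEdge G u))
e≡∑∑forwardEdge G =
  trans (cong sum (LP.map-tabulate {n = n G} (λ u → u) (λ u → sum (L.map (forwardEdge G u) (L.allFin (n G))))))
        (∑-cong λ u → cong sum (LP.map-tabulate {n = n G} (λ w → w) (forwardEdge G u)))

forwardEdge-irrefl : ∀ G u → forwardEdge G u u ≡ 0
forwardEdge-irrefl G u rewrite <ᵇ-false (ℕP.≤-refl {toℕ u}) = refl

forwardEdge-─ : ∀ G v i j → forwardEdge (G ─ v) i j ≡ forwardEdge G (skip v i) (skip v j)
forwardEdge-─ record { n = suc _ } v i j rewrite <ᵇ-punchIn v i j = refl

forwardEdge-pair : ∀ G {u w} → u ≢ w → forwardEdge G u w ℕ.+ forwardEdge G w u ≡ 𝟙 (adj G u w)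
forwardEdge-pair G {u} {w} u≢w with FP.<-cmp u w
... | tri< u<w _ _ rewrite <ᵇ-true u<w | <ᵇ-false (ℕP.<⇒≤ u<w) = ℕP.+-identityʳ _
... | tri≈ _ u≡w _ = ⊥-elim (u≢w u≡w)
... | tri> _ _ w<u rewrite <ᵇ-true w<u | <ᵇ-false (ℕP.<⇒≤ w<u) = cong 𝟙 (sym G w u)

degree-─ : ∀ G v → degree G v ≡ ∑ (λ i → 𝟙 (adj G v (skip v i)))
degree-─ G v rewrite ∑-split v (𝟙 ∘ adj G v) | irrefl G v = refl

e-─ : ∀ G v → e G ≡ degree G v ℕ.+ e (G ─ v)
e-─ G v = begin
  e G                                    ≡⟨ e≡∑∑forwardEdge G ⟩
  ∑ (λ u → ∑ (c u))                      ≡⟨ ∑-split v _ ⟩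
  ∑ (c v) ℕ.+ ∑ (λ i → ∑ (c (s i)))      ≡⟨ cong₂ ℕ._+_ row-v rows-─ ⟩
  outgoing ℕ.+ (incoming ℕ.+ inner)      ≡⟨ ℕP.+-assoc outgoing incoming inner ⟨
  (outgoing ℕ.+ incoming) ℕ.+ inner      ≡⟨ cong₂ ℕ._+_ incident inner≡e ⟩
  degree G v ℕ.+ e (G ─ v)               ∎
  where
  open Eq.≡-Reasoning
  c : Fin (n G) → Fin (n G) → ℕ
  c = forwardEdge G
  s : Fin (n (G ─ v)) → Fin (n G)
  s = skip v
  outgoing incoming inner : ℕ
  outgoing = ∑ (λ i → c v (s i))
  incoming = ∑ (λ i → c (s i) v)
  inner    = ∑ (λ i → ∑ (λ j → c (s i) (s j)))

  row-v : ∑ (c v) ≡ outgoing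
  row-v = trans (∑-split v (c v)) (cong (ℕ._+ outgoing) (forwardEdge-irrefl G v))

  rows-─ : ∑ (λ i → ∑ (c (s i))) ≡ incoming ℕ.+ inner
  rows-─ = trans (∑-cong λ i → ∑-split v (c (s i))) (∑-distrib-+ (λ i → c (s i) v) _)

  incident : outgoing ℕ.+ incoming ≡ degree G v
  incident = begin
    outgoing ℕ.+ incoming                 ≡⟨ ∑-distrib-+ (λ i → c v (s i)) (λ i → c (s i) v) ⟨
    ∑ (λ i → c v (s i) ℕ.+ c (s i) v)     ≡⟨ ∑-cong (λ i → forwardEdge-pair G (skip-≢ v i ∘ Eq.sym)) ⟩
    ∑ (λ i → 𝟙 (adj G v (s i)))           ≡⟨ degree-─ G v ⟨
    degree G v                            ∎

  inner≡e : inner ≡ e (G ─ v)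
  inner≡e = trans (∑-cong λ i → ∑-cong λ j → Eq.sym (forwardEdge-─ G v i j)) (Eq.sym (e≡∑∑forwardEdge (G ─ v)))

neighbourhood : (G : Graph) → Fin (n G) → Subset (n G)
neighbourhood G v = V.tabulate (adj G v)

∈-neighbourhood⁺ : ∀ G {v w} → adj G v w ≡ true → w S.∈ neighbourhood G v
∈-neighbourhood⁺ G {v} {w} v~w = VP.lookup⇒[]= w _ (trans (VP.lookup∘tabulate (adj G v) w) v~w)

∈-neighbourhood⁻ : ∀ G {v w} → w S.∈ neighbourhood G v → adj G v w ≡ true
∈-neighbourhood⁻ G {v} {w} w∈ = trans (Eq.sym (VP.lookup∘tabulate (adj G v) w)) (VP.[]=⇒lookup w∈)

3≤degree : ∀ G {v} → ThreeMembers (neighbourhood G v) → 3 ℕ.≤ degree G v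
3≤degree G {v} = 3≤∑ (𝟙 ∘ adj G v) positive
  where
  positive : ∀ {w} → w S.∈ neighbourhood G v → 1 ℕ.≤ 𝟙 (adj G v w)
  positive w∈ rewrite ∈-neighbourhood⁻ G w∈ = ℕP.≤-refl

separated-by-neighbourhood : ∀ G {v w} → w ≢ v → ¬ ReachAvoid G (neighbourhood G v) v w
separated-by-neighbourhood G w≢v here              = w≢v refl
separated-by-neighbourhood G w≢v (step v~u u∉ _) = u∉ (∈-neighbourhood⁺ G v~u)

non-neighbour : ∀ G v → 4 ℕ.≤ n G → ¬ ThreeMembers (neighbourhood G v) → ∃ λ w → w ≢ v × adj G v w ≡ false
non-neighbour G v 4≤n few with ThreeMembers-⊤ (ℕP.pred-mono-≤ 4≤n)
... | a , b , c , (a≢b , a≢c , b≢c) , _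
    with adj G v (skip v a) in v~a | adj G v (skip v b) in v~b | adj G v (skip v c) in v~c
...   | false | _     | _     = skip v a , skip-≢ v a , v~a
...   | true  | false | _     = skip v b , skip-≢ v b , v~b
...   | true  | true  | false = skip v c , skip-≢ v c , v~c
...   | true  | true  | true  = ⊥-elim (few
  ( skip v a , skip v b , skip v c
  , (a≢b ∘ skip-injective v , a≢c ∘ skip-injective v , b≢c ∘ skip-injective v)
  , (∈-neighbourhood⁺ G v~a , ∈-neighbourhood⁺ G v~b , ∈-neighbourhood⁺ G v~c)))

sparse-neighbourhood-ΨCut : ∀ Ψ G v → 4 ℕ.≤ n G → ¬ ThreeMembers (neighbourhood G v) →
  ΨCut Ψ G (neighbourhood G v)
sparse-neighbourhood-ΨCut Ψ G v 4≤n few with non-neighbour G v 4≤n few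
... | w , w≢v , v≁w =
  (v , w , v∉ , w∉ , separated-by-neighbourhood G w≢v) , sparse⇒InClass Ψ G few
  where
  v∉ : v S.∉ neighbourhood G v
  v∉ v∈ = adj⇒≢ G (∈-neighbourhood⁻ G v∈) refl
  w∉ : w S.∉ neighbourhood G v
  w∉ w∈ with trans (Eq.sym (∈-neighbourhood⁻ G w∈)) v≁w
  ... | ()

record Embedding (G : Graph) (M : Subset (n G)) (H : Graph) (M′ : Subset (n H)) : Set where
  field
    φ           : Fin (n G) → Fin (n H)
    φ-∈         : ∀ {u} → u S.∈ M → φ u S.∈ M′
    φ-injective : ∀ {u w} → u S.∈ M → w S.∈ M → φ u ≡ φ w → u ≡ w
    φ-adj       : ∀ {u w} → u S.∈ M → w S.∈ M → adj G u w ≡ true → adj H (φ u) (φ w) ≡ true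

module _ {G H : Graph} {M : Subset (n G)} {M′ : Subset (n H)} (f : Embedding G M H M′) where
  open Embedding f

  private
    map-All : ∀ {us} → All (S._∈ M) us → All (S._∈ M′) (L.map φ us)
    map-All = AllP.map⁺ ∘ All.map φ-∈

    map-Unique : ∀ {us} → All (S._∈ M) us → Unique us → Unique (L.map φ us)
    map-Unique []         []           = []
    map-Unique (u∈ ∷ us∈) (u≢us ∷ uniq) =
      AllP.map⁺ (All.zipWith (λ (w∈ , u≢w) → u≢w ∘ φ-injective u∈ w∈) (us∈ , u≢us)) ∷ map-Unique us∈ uniq

    map-AdjChain : ∀ {us} → All (S._∈ M) us → AdjChain G us → AdjChain H (L.map φ us)
    map-AdjChain []                  _             = tt
    map-AdjChain (_ ∷ [])            _             = tt
    map-AdjChain (u∈ ∷ w∈ ∷ us∈) (u~w , chain) = φ-adj u∈ w∈ u~w , map-AdjChain (w∈ ∷ us∈) chain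

    map-cycle : HasCycleIn G M → HasCycleIn H M′
    map-cycle (_ , x , y , z , rest , refl , uniq , all∈@(x∈ ∷ _) , chain) =
      _ , φ x , φ y , φ z , L.map φ rest , refl , map-Unique all∈ uniq , map-All all∈ ,
      subst (AdjChain H) (LP.map-++ φ (x ∷ y ∷ z ∷ rest) L.[ x ]) (map-AdjChain (AllP.++⁺ all∈ (x∈ ∷ [])) chain)

  InClass-embedding : ∀ Ψ → InClass Ψ H M′ → InClass Ψ G M
  InClass-embedding 𝔉 acyclic                = acyclic ∘ map-cycle
  InClass-embedding 𝔅 (colour , proper) =
    colour ∘ φ , λ u w u∈ w∈ u~w → proper (φ u) (φ w) (φ-∈ u∈) (φ-∈ w∈) (φ-adj u∈ w∈ u~w)

extend : ∀ {k} → Fin k → Subset (pred k) → Subset k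
extend {suc _} v M = V.insertAt M v outside

extend-∌ : ∀ {k} (v : Fin k) {M w} → w S.∈ extend v M → w ≢ v
extend-∌ {suc _} v {M} w∈ refl with trans (Eq.sym (VP.[]=⇒lookup w∈)) (VP.insertAt-lookup M v outside)
... | ()

lookup-extend-skip : ∀ {k} (v : Fin k) M i → V.lookup (extend v M) (skip v i) ≡ V.lookup M i
lookup-extend-skip {suc _} v M i = VP.insertAt-punchIn M v outside i

skip-∈-extend⁺ : ∀ {k} (v : Fin k) {M i} → i S.∈ M → skip v i S.∈ extend v M
skip-∈-extend⁺ v {M} {i} i∈ = VP.lookup⇒[]= _ _ (trans (lookup-extend-skip v M i) (VP.[]=⇒lookup i∈))

skip-∈-extend⁻ : ∀ {k} (v : Fin k) {M i} → skip v i S.∈ extend v M → i S.∈ M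
skip-∈-extend⁻ v {M} {i} i∈ = VP.lookup⇒[]= _ _ (trans (Eq.sym (lookup-extend-skip v M i)) (VP.[]=⇒lookup i∈))

module Lowering (G : Graph) (v : Fin (n G)) (d : Fin (n (G ─ v))) {M : Subset (n (G ─ v))} where

  ρ : Fin (n G) → Fin (n (G ─ v))
  ρ = unskip v d

  ρ-adj : ∀ {a b} → a ≢ v → b ≢ v → adj G a b ≡ true → adj (G ─ v) (ρ a) (ρ b) ≡ true
  ρ-adj a≢v b≢v = trans (cong₂ (adj G) (skip-unskip v d a≢v) (skip-unskip v d b≢v))

  ρ-∈ : ∀ {a} → a S.∈ extend v M → ρ a S.∈ M
  ρ-∈ a∈ = skip-∈-extend⁻ v (subst (S._∈ extend v M) (Eq.sym (skip-unskip v d (extend-∌ v a∈))) a∈)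

  ρ-∉ : ∀ {a} → a ≢ v → a S.∉ extend v M → ρ a S.∉ M
  ρ-∉ a≢v a∉ = a∉ ∘ subst (S._∈ extend v M) (skip-unskip v d a≢v) ∘ skip-∈-extend⁺ v

  ρ-embedding : Embedding G (extend v M) (G ─ v) M
  ρ-embedding = record
    { φ           = ρ
    ; φ-∈         = ρ-∈
    ; φ-injective = λ a∈ b∈ ρa≡ρb → trans (Eq.sym (skip-unskip v d (extend-∌ v a∈)))
                                          (trans (cong (skip v) ρa≡ρb) (skip-unskip v d (extend-∌ v b∈)))
    ; φ-adj       = λ a∈ b∈ → ρ-adj (extend-∌ v a∈) (extend-∌ v b∈)
    }

  -- A detour s – v – u through v is replaced by the edge su of the clique N(v).
  ρ-reach : NeighbourhoodComplete G v → ∀ {s t} → s ≢ v → t ≢ v →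
    ReachAvoid G (extend v M) s t → ReachAvoid (G ─ v) M (ρ s) (ρ t)
  ρ-reach simplicial s≢v t≢v here = here
  ρ-reach simplicial s≢v t≢v (step {v = u} s~u u∉ r) with u F.≟ v
  ... | no u≢v = step (ρ-adj s≢v u≢v s~u) (ρ-∉ u≢v u∉) (ρ-reach simplicial u≢v t≢v r)
  ρ-reach simplicial s≢v t≢v (step _ _ here) | yes refl = ⊥-elim (t≢v refl)
  ρ-reach simplicial {s} s≢v t≢v (step s~v _ (step {v = u} v~u u∉ r)) | yes refl with u F.≟ s
  ... | yes refl = ρ-reach simplicial s≢v t≢v r
  ... | no u≢s   =
    step (ρ-adj s≢v u≢v (simplicial s u (trans (sym G v s) s~v) v~u (u≢s ∘ Eq.sym)))
         (ρ-∉ u≢v u∉) (ρ-reach simplicial u≢v t≢v r)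
    where
    u≢v : u ≢ v
    u≢v = adj⇒≢ G v~u ∘ Eq.sym

ΨCut-extend : ∀ Ψ G v {M} → NeighbourhoodComplete G v → ΨCut Ψ (G ─ v) M → ΨCut Ψ G (extend v M)
ΨCut-extend Ψ G v {M} simplicial ((i , j , i∉ , j∉ , disconnected) , inΨ) =
  (skip v i , skip v j , i∉ ∘ skip-∈-extend⁻ v , j∉ ∘ skip-∈-extend⁻ v , disconnected ∘ lower) ,
  InClass-embedding ρ-embedding Ψ inΨ
  where
  open Lowering G v i {M}
  lower : ReachAvoid G (extend v M) (skip v i) (skip v j) → ReachAvoid (G ─ v) M i j
  lower = subst₂ (ReachAvoid (G ─ v) M) (unskip-skip v i i) (unskip-skip v i j)
        ∘ ρ-reach simplicial (skip-≢ v i) (skip-≢ v j)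

ℕ→ℚ≡mkℚ : ∀ k → ℕ→ℚ k ≡ Q.mkℚ (ℤ.+ k) 0 (Cop.sym (Cop.1-coprimeTo k))
ℕ→ℚ≡mkℚ k = QP.↥p/↧p≡p (Q.mkℚ (ℤ.+ k) 0 (Cop.sym (Cop.1-coprimeTo k)))

ℕ→ℚ-+ : ∀ a b → ℕ→ℚ (a ℕ.+ b) ≡ ℕ→ℚ a Q.+ ℕ→ℚ b
ℕ→ℚ-+ a b rewrite ℕ→ℚ≡mkℚ a | ℕ→ℚ≡mkℚ b | ℕP.*-identityʳ a | ℕP.*-identityʳ b
  | ℤP.+◃n≡+n a | ℤP.+◃n≡+n b = refl

ℕ→ℚ-mono-≤ : ∀ {a b} → a ℕ.≤ b → ℕ→ℚ a ≤ ℕ→ℚ b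
ℕ→ℚ-mono-≤ {a} {b} a≤b rewrite ℕ→ℚ≡mkℚ a | ℕ→ℚ≡mkℚ b =
  Q.*≤* (subst₂ ℤ._≤_ (Eq.sym (ℤP.*-identityʳ (ℤ.+ a))) (Eq.sym (ℤP.*-identityʳ (ℤ.+ b))) (ℤ.+≤+ a≤b))

p≤r⇒0≤r-p : ∀ {p r : ℚ} → p ≤ r → Q.0ℚ ≤ r - p
p≤r⇒0≤r-p {p} {r} p≤r = subst (_≤ r - p) (QP.+-inverseʳ p) (QP.+-monoˡ-≤ (Q.- p) p≤r)

q-─ : ∀ α β G v → q α β (G ─ v) ≡ q α β G Q.+ (ℕ→ℚ (degree G v) - α)
q-─ α β G v = begin
  α * m - E - β
    ≡⟨ solve 5 (λ α β m d E → α :* m :- E :- β := α :* (con Q.1ℚ :+ m) :- (d :+ E) :- β :+ (d :- α))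
             refl α β m d E ⟩
  α * (Q.1ℚ Q.+ m) - (d Q.+ E) - β Q.+ (d - α)
    ≡⟨ cong₂ (λ a b → α * a - b - β Q.+ (d - α))
             (Eq.sym (trans (cong ℕ→ℚ (Eq.sym (suc-pred v))) (ℕ→ℚ-+ 1 (n (G ─ v)))))
             (Eq.sym (trans (cong ℕ→ℚ (e-─ G v)) (ℕ→ℚ-+ (degree G v) (e (G ─ v))))) ⟩
  q α β G Q.+ (d - α) ∎
  where
  open Eq.≡-Reasoning
  open ℚ-Solver
  m d E : ℚ
  m = ℕ→ℚ (n (G ─ v))
  d = ℕ→ℚ (degree G v)
  E = ℕ→ℚ (e (G ─ v))

q-K₄ : ∀ α β G → ℕ→ℚ 4 * α - β ≡ ℕ→ℚ 6 → n G ≡ 4 → e G ≡ 6 → q α β G ≡ Q.0ℚ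
q-K₄ α β G 4α-β≡6 n≡4 e≡6 = begin
  q α β G                     ≡⟨ cong₂ (λ a b → α * ℕ→ℚ a - ℕ→ℚ b - β) n≡4 e≡6 ⟩
  α * ℕ→ℚ 4 - ℕ→ℚ 6 - β     ≡⟨ solve 4 (λ α β f s → α :* f :- s :- β := (f :* α :- β) :- s) refl α β (ℕ→ℚ 4) (ℕ→ℚ 6) ⟩
  ℕ→ℚ 4 * α - β - ℕ→ℚ 6     ≡⟨ cong (_- ℕ→ℚ 6) 4α-β≡6 ⟩
  ℕ→ℚ 6 - ℕ→ℚ 6             ≡⟨ QP.+-inverseʳ (ℕ→ℚ 6) ⟩
  Q.0ℚ ∎
  where
  open Eq.≡-Reasoning
  open ℚ-Solver

─-admissible : ∀ {Ψ α β} G v → α ≤ ℕ→ℚ 3 → NeighbourhoodComplete G v → ThreeMembers (neighbourhood G v) →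
  4 ℕ.≤ n (G ─ v) → Admissible Ψ α β G → Admissible Ψ α β (G ─ v)
─-admissible {Ψ} {α} {β} G v α≤3 simplicial three 4≤n-1 (_ , q>0 , no-cut) =
  4≤n-1 ,
  subst (Q.0ℚ <_) (Eq.sym (q-─ α β G v)) (QP.+-mono-<-≤ q>0 (p≤r⇒0≤r-p α≤degree)) ,
  λ M cut → no-cut (extend v M) (ΨCut-extend Ψ G v simplicial cut)
  where
  α≤degree : α ≤ ℕ→ℚ (degree G v)
  α≤degree = QP.≤-trans α≤3 (ℕ→ℚ-mono-≤ (3≤degree G three))

Fin4-exhausted : (v x y z w : Fin 4) → x ≢ v → y ≢ v → z ≢ v → x ≢ y → x ≢ z → y ≢ z → w ≢ v →
  w ≡ x ⊎ w ≡ y ⊎ w ≡ z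
Fin4-exhausted = from-yes (FP.all? {n = 4} λ v → FP.all? λ x → FP.all? λ y → FP.all? λ z → FP.all? λ w →
  ¬? (x F.≟ v) →-dec ¬? (y F.≟ v) →-dec ¬? (z F.≟ v) →-dec
  ¬? (x F.≟ y) →-dec ¬? (x F.≟ z) →-dec ¬? (y F.≟ z) →-dec ¬? (w F.≟ v) →-dec
  ((w F.≟ x) ⊎-dec (w F.≟ y) ⊎-dec (w F.≟ z)))

universal⇒complete : ∀ G v → NeighbourhoodComplete G v → (∀ w → w ≢ v → adj G v w ≡ true) →
  ∀ i j → i ≢ j → adj G i j ≡ true
universal⇒complete G v simplicial universal i j i≢j with i F.≟ v | j F.≟ v
... | yes refl | yes refl = ⊥-elim (i≢j refl)
... | yes refl | no j≢v   = universal j j≢v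
... | no i≢v   | yes refl = trans (sym G i v) (universal i i≢v)
... | no i≢v   | no j≢v   = simplicial i j (universal i i≢v) (universal j j≢v) i≢j

e-K₄ : ∀ G → n G ≡ 4 → (∀ i j → i ≢ j → adj G i j ≡ true) → e G ≡ 6
e-K₄ record { adj = A } refl complete
  with A zero (suc zero)                   | complete zero (suc zero) (λ ())
     | A zero (suc (suc zero))             | complete zero (suc (suc zero)) (λ ())
     | A zero (suc (suc (suc zero)))       | complete zero (suc (suc (suc zero))) (λ ())
     | A (suc zero) (suc (suc zero))       | complete (suc zero) (suc (suc zero)) (λ ())
     | A (suc zero) (suc (suc (suc zero))) | complete (suc zero) (suc (suc (suc zero))) (λ ())
     | A (suc (suc zero)) (suc (suc (suc zero))) | complete (suc (suc zero)) (suc (suc (suc zero))) (λ ())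
... | _ | refl | _ | refl | _ | refl | _ | refl | _ | refl | _ | refl = refl

simplicial-K₄ : ∀ G v → n G ≡ 4 → NeighbourhoodComplete G v → ThreeMembers (neighbourhood G v) → e G ≡ 6
simplicial-K₄ G v n≡4@refl simplicial (x , y , z , (x≢y , x≢z , y≢z) , (x∈ , y∈ , z∈)) =
  e-K₄ G n≡4 (universal⇒complete G v simplicial universal)
  where
  ≢v : ∀ {w} → w S.∈ neighbourhood G v → w ≢ v
  ≢v w∈ = adj⇒≢ G (∈-neighbourhood⁻ G {v} w∈) ∘ Eq.sym
  universal : ∀ w → w ≢ v → adj G v w ≡ true
  universal w w≢v = covered (Fin4-exhausted v x y z w (≢v x∈) (≢v y∈) (≢v z∈) x≢y x≢z y≢z w≢v)
    where
    covered : w ≡ x ⊎ w ≡ y ⊎ w ≡ z → adj G v w ≡ true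
    covered (inj₁ refl)        = ∈-neighbourhood⁻ G {v} x∈
    covered (inj₂ (inj₁ refl)) = ∈-neighbourhood⁻ G {v} y∈
    covered (inj₂ (inj₂ refl)) = ∈-neighbourhood⁻ G {v} z∈

lemma11 : (Ψ : Ψ-Class) (α β : ℚ) →
    ℕ→ℚ 2 < α → α ≤ ℕ→ℚ 3 → ℕ→ℚ 4 * α - β ≡ ℕ→ℚ 6 →
    (G : Graph) → In𝒢 Ψ α β G →
    (v : Fin (n G)) → ¬ NeighbourhoodComplete G v
lemma11 Ψ α β _ α≤3 4α-β≡6 G (admissible@(4≤n , q>0 , no-cut) , minimal) v simplicial =
  cases (threeMembers? (neighbourhood G v)) (n G ℕ.≟ 4)
  where
  cases : Dec (ThreeMembers (neighbourhood G v)) → Dec (n G ≡ 4) → ⊥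
  cases (no few) _ = no-cut (neighbourhood G v) (sparse-neighbourhood-ΨCut Ψ G v 4≤n few)
  cases (yes three) (yes n≡4) =
    QP.<-irrefl (Eq.sym (q-K₄ α β G 4α-β≡6 n≡4 (simplicial-K₄ G v n≡4 simplicial three))) q>0
  cases (yes three) (no n≢4) =
    ℕP.1+n≰n (subst (ℕ._≤ pred (n G)) (Eq.sym (suc-pred v)) (minimal (G ─ v) admissible-─))
    where
    4≤n-1 : 4 ℕ.≤ n (G ─ v)
    4≤n-1 = ℕP.pred-mono-≤ {5} (ℕP.≤∧≢⇒< 4≤n (n≢4 ∘ Eq.sym))
    admissible-─ : Admissible Ψ α β (G ─ v)
    admissible-─ = ─-admissible G v α≤3 simplicial three 4≤n-1 admissible
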